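{- Let $a,b,s,h$ be positive integers with $s\ge2$ and $r=a+b$. Let $\mathcal G\subseteq\binom{[n]}{r}$ with $|\mathcal G|>\frac{1}{c(r,shr)}n^{r-2}$ be a family not containing $\mathcal B_{s,h}(a,b)$, and let $\mathcal G^*\subseteq\mathcal G$, with $r$-partition $(X_1,\dots,X_r)$ and family $\mathcal J$ of proper subsets of $[r]$, be a subfamily satisfying conditions 1–5 of the intersection semilattice lemma (described in the context) with $q=shr$ (here $\mathcal J$ is necessarily $(r-2)$-covering). Then $\mathcal J$ does not contain two disjoint members $A$ and $B$ with $|A|=a$ and $|B|=b$.
   Context: A $q$-star with kernel $K$ is a family $\{F_1,\dots,F_q\}$ with $F_i\cap F_j=K$ for $i\neq j$. For $F\in\mathcal F$, $\mathcal I(F,\mathcal F)=\{F\cap F':F'\in\mathcal F\setminus\{F\}\}$. A family $\mathcal F\subseteq\binom{[n]}{r}$ is $r$-partite with partition $(X_1,\dots,X_r)$ of $[n]$ if $|F\cap X_i|=1$ for all $F\in\mathcal F$, $i\in[r]$; for $S\subseteq[n]$, $\Pi(S)=\{i\in[r]:S\cap X_i\ne\emptyset\}$, and $\Pi(\mathcal L)=\{\Pi(S):S\in\mathcal L\}$. Intersection semilattice lemma (Füredi): for all positive integers $q,r$ there is $c(r,q)>0$ such that every $\mathcal F\subseteq\binom{[n]}{r}$ contains $\mathcal F^*$ with (1) $|\mathcal F^*|\ge c(r,q)|\mathcal F|$; (2) $\mathcal F^*$ is $r$-partite with some partition $(X_1,\dots,X_r)$; (3) there is a family $\mathcal J$ of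 proper subsets of $[r]$ with $\Pi(\mathcal I(F,\mathcal F^*))=\mathcal J$ for all $F\in\mathcal F^*$; (4) $\mathcal J$ is closed under intersection; (5) for every $F\in\mathcal F^*$ and $A\in\mathcal I(F,\mathcal F^*)$ there is a $q$-star in $\mathcal F^*$ containing $F$ with kernel $A$. $\mathcal J$ is $(r-2)$-covering if every $(r-2)$-subset of $[r]$ lies in some member of $\mathcal J$. The bush $\mathcal B_{s,h}(a,b)$ is the $r$-graph on pairwise disjoint sets $A$ ($|A|=a$), $B_1,\dots,B_s$ (size $b$), $A_{i,j}$ ($i\in[s],j\in[h]$, size $a$) with edges $A\cup B_i$ and $B_i\cup A_{i,j}$; "contains" means has a subfamily isomorphic to it. -}

module Defs where

open import Data.Nat using (ℕ; zero; suc; _+_; _*_; _∸_; _^_; _≤_; _<_)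
open import Data.Fin using (Fin)
open import Data.Fin.Subset using (Subset; _∩_; ∣_∣; ⊤; Nonempty)
  renaming (_∈_ to _∈ₛ_)
open import Data.Vec using (tabulate)
open import Data.Bool using (true; false; not)
open import Data.Nat using (_≡ᵇ_)
open import Data.Fin using () renaming (_≟_ to _≟ᶠ_)
open import Relation.Nullary.Decidable using (⌊_⌋)
open import Level using (0ℓ)
open import Data.List using (List; length)
open import Data.List.Membership.Propositional using (_∈_)
open import Data.List.Relation.Unary.Unique.Propositional using (Unique)
open import Data.Product using (Σ; ∃; ∃-syntax; _×_; _,_)
open import Data.Sum using (_⊎_)
open import Relation.Nullary using (¬_)
open import Relation.Unary using (Pred)
open import Relation.Binary.PropositionalEquality using (_≡_; _≢_)
open import Function.Bundles using (_⇔_)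
open import Function.Definitions using (Injective)
open import Data.Integer using (+_)
open import Data.Rational using (ℚ; _/_)

ℕ→ℚ : ℕ → ℚ
ℕ→ℚ k = + k / 1

Family : ℕ → Set
Family n = List (Subset n)

-- |F| = size of the family (the list is assumed duplicate-free where used)
∣_∣F : ∀ {n} → Family n → ℕ
∣ 𝓕 ∣F = length 𝓕

Uniform : ∀ {n} → ℕ → Family n → Set
Uniform r 𝓕 = ∀ {F} → F ∈ 𝓕 → ∣ F ∣ ≡ r

Subfamily : ∀ {n} → Family n → Family n → Set
Subfamily 𝓕 𝓖 = ∀ {F} → F ∈ 𝓕 → F ∈ 𝓖

-- A partition (X_1,…,X_r) of [n] is given by the part-index map X : Fin n → Fin r;
-- X_i = { v | X v ≡ i }.
Part : ∀ {n r} → (Fin n → Fin r) → Fin r → Subset n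
Part X i = tabulate λ v → ⌊ X v ≟ᶠ i ⌋

Partite : ∀ {n r} → (Fin n → Fin r) → Family n → Set
Partite {r = r} X 𝓕 = ∀ {F} → F ∈ 𝓕 → (i : Fin r) → ∣ F ∩ Part X i ∣ ≡ 1

Π : ∀ {n r} → (Fin n → Fin r) → Subset n → Subset r
Π X S = tabulate λ i → not (∣ S ∩ Part X i ∣ ≡ᵇ 0)

InI : ∀ {n} → Subset n → Family n → Subset n → Set
InI F 𝓕 A = ∃[ F' ] (F' ∈ 𝓕 × F' ≢ F × A ≡ F ∩ F')

InΠI : ∀ {n r} → (Fin n → Fin r) → Subset n → Family n → Subset r → Set
InΠI X F 𝓕 S = ∃[ A ] (InI F 𝓕 A × Π X A ≡ S)

StarThrough : ∀ {n} → ℕ → Family n → Subset n → Subset n → Set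
StarThrough {n} q 𝓕 F K =
  Σ (Fin q → Subset n) λ S →
    (∀ i → S i ∈ 𝓕) ×
    (∀ i j → i ≢ j → S i ≢ S j) ×
    (∀ i j → i ≢ j → S i ∩ S j ≡ K) ×
    (∃[ i ] S i ≡ F)

-- Conditions (2)–(5) of the intersection semilattice lemma for 𝓖* with partition X,
-- family 𝓙 (a set of subsets of [r], given as a predicate) and parameter q.
-- (Condition (1) involves the constant c and is stated separately.)
Semilattice : ∀ {n r} → ℕ → Family n → (Fin n → Fin r) → Pred (Subset r) 0ℓ → Set
Semilattice {n} {r} q 𝓖* X 𝓙 =
  Partite X 𝓖* ×
  (∀ {J} → 𝓙 J → J ≢ ⊤) ×
  (∀ {F} → F ∈ 𝓖* → ∀ J → (𝓙 J ⇔ InΠI X F 𝓖* J)) ×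
  (∀ {A B} → 𝓙 A → 𝓙 B → 𝓙 (A ∩ B)) ×
  (∀ {F} → F ∈ 𝓖* → ∀ A → InI F 𝓖* A → StarThrough q 𝓖* F A)

-- Vertices of the bush 𝓑_{s,h}(a,b): A (size a), B_i (i ∈ [s], size b),
-- A_{i,j} (i ∈ [s], j ∈ [h], size a); pairwise disjoint by construction.
data BushV (a b s h : ℕ) : Set where
  vA : Fin a → BushV a b s h
  vB : Fin s → Fin b → BushV a b s h
  vC : Fin s → Fin h → Fin a → BushV a b s h

ContainsBush : ∀ {n} → (a b s h : ℕ) → Family n → Set
ContainsBush {n} a b s h 𝓖 =
  Σ (BushV a b s h → Fin n) λ φ →
    Injective _≡_ _≡_ φ ×
    (∀ i → ∃[ E ] (E ∈ 𝓖 × (∀ v → (v ∈ₛ E) ⇔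
        ((∃[ k ] φ (vA k) ≡ v) ⊎ (∃[ k ] φ (vB i k) ≡ v))))) ×
    (∀ i j → ∃[ E ] (E ∈ 𝓖 × (∀ v → (v ∈ₛ E) ⇔
        ((∃[ k ] φ (vB i k) ≡ v) ⊎ (∃[ k ] φ (vC i j k) ≡ v)))))

-- Pick F ∈ 𝓖* (nonempty by the size bounds). Since A ∈ 𝓙, F lies in a q-star whose kernel is
-- the trace of F on the parts in A; let P₁,…,Pₛ be petals of it. Since B ∈ 𝓙, each Pᵢ lies in a
-- q-star whose kernel is its trace on B. As A and B split the r parts, the petals of this star
-- differ exactly in their A-vertices, which are pairwise disjoint; as q = shr > sha, one can pick
-- greedily h petals for every Pᵢ whose A-vertices avoid those of F and of each other. The
-- A-vertices of F, the B-vertices of the Pᵢ and the A-vertices of the picked petals then span a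
-- copy of 𝓑_{s,h}(a,b) in 𝓖* ⊆ 𝓖.
module Submission where

open import Defs
open import Data.Nat using (ℕ; zero; suc; _+_; _*_; _∸_; _^_; _≤_; _<_; _≡ᵇ_; z≤n; s≤s; >-nonZero)
open import Data.Nat.Properties using (≤-trans; m≤m*n; *-mono-≤; *-distribˡ-+; m<m+n; +-assoc; +-comm; +-monoˡ-<; +-cancelʳ-<; +-monoʳ-≤; ≤-<-trans; m≤m+n; <⇒≱; <-irrefl; m+n∸m≡n)
open import Data.Fin using (Fin; zero; suc; inject≤; combine; remQuot; punchIn) renaming (_≟_ to _≟ᶠ_)
open import Data.Fin.Properties using (¬∀⟶∃¬; suc-injective; any?; injective⇒≤; inject≤-injective; remQuot-combine; combine-injective; punchInᵢ≢i)
open import Data.Fin.Subset using (Subset; inside; outside; _∩_; ∣_∣; ⊥; ⁅_⁆; ∁; Nonempty; _⊆_; _⊂_)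
  renaming (_∈_ to _∈ₛ_; _∉_ to _∉ₛ_)
open import Data.Fin.Subset.Properties using (nonempty?; Empty-unique; ∣⊥∣≡0; ∉⊥; x∈p∩q⁺; x∈p∩q⁻;
  x∈⁅y⁆⇒x≡y; ∣⁅x⁆∣≡1; p⊆q⇒∣p∣≤∣q∣; p⊂q⇒∣p∣<∣q∣; x∉p⇒x∈∁p; ∣∁p∣≡n∸∣p∣) renaming (_∈?_ to _∈ₛ?_)
open import Data.Vec using (_∷_; tabulate; here; there)
open import Data.Vec.Properties using (lookup∘tabulate; []=⇒lookup; lookup⇒[]=)
open import Data.Bool using (Bool; true; not)
open import Data.Bool.Properties using (T-≡)
open import Data.List using (List; _∷_; length; _++_) renaming (tabulate to tabulateᴸ; lookup to lookupᴸ)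
open import Data.List.Properties using (length-++; length-tabulate)
open import Data.List.Membership.Propositional using (_∈_; _∉_)
open import Data.List.Membership.Propositional.Properties using (∈-++⁺ˡ; ∈-++⁺ʳ) renaming (∈-tabulate⁺ to ∈ᴸ-tabulate⁺)
import Data.List.Membership.DecPropositional as DecMembership
open import Data.List.Relation.Unary.Any using (here; index)
open import Data.List.Relation.Unary.Any.Properties using (lookup-index)
open import Data.List.Relation.Unary.Unique.Propositional using (Unique)
open import Data.Product using (Σ; ∃; ∃-syntax; ∃!; _×_; _,_; proj₁; proj₂)
open import Data.Sum using (_⊎_; inj₁; inj₂)
open import Data.Sum.Algebra using (⊎-comm)
open import Data.Empty using (⊥-elim)
open import Relation.Nullary using (¬_; yes; no; contradiction)
open import Relation.Nullary.Decidable using (⌊_⌋; isYes≗does; dec-true; toWitness)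
open import Relation.Unary using (Pred)
open import Relation.Binary.Definitions using (DecidableEquality)
open import Relation.Binary.PropositionalEquality using (_≡_; _≢_; refl; sym; trans; cong; subst; module ≡-Reasoning)
open import Function.Bundles using (_⇔_; mk⇔; Equivalence)
open import Function.Definitions using (Injective)
import Function.Properties.Equivalence as ⇔
open import Function.Properties.Inverse using (↔⇒⇔)
open import Level using (0ℓ)
open import Data.Rational using (ℚ; Positive; NonNegative; NonZero; positive; 1/_; _÷_) renaming (_*_ to _*ℚ_; _<_ to _<ℚ_; _≤_ to _≤ℚ_)
open import Data.Rational.Properties using (pos⇒nonZero)
import Data.Rational.Properties as ℚ

∣p∣≢0⇒Nonempty : ∀ {n} (p : Subset n) → ∣ p ∣ ≢ 0 → Nonempty p
∣p∣≢0⇒Nonempty {n} p ∣p∣≢0 with nonempty? p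
... | yes ne = ne
... | no empty = contradiction (trans (cong ∣_∣ (Empty-unique empty)) (∣⊥∣≡0 n)) ∣p∣≢0

x∈p⇒⁅x⁆⊆p : ∀ {n} {p : Subset n} {x} → x ∈ₛ p → ⁅ x ⁆ ⊆ p
x∈p⇒⁅x⁆⊆p {p = p} {x} x∈p y∈⁅x⁆ = subst (_∈ₛ p) (sym (x∈⁅y⁆⇒x≡y x y∈⁅x⁆)) x∈p

x∈p⇒∣p∣≢0 : ∀ {n} {p : Subset n} {x} → x ∈ₛ p → ∣ p ∣ ≢ 0
x∈p⇒∣p∣≢0 {p = p} {x} x∈p ∣p∣≡0 with subst (1 ≤_) ∣p∣≡0 (subst (_≤ ∣ p ∣) (∣⁅x⁆∣≡1 x) (p⊆q⇒∣p∣≤∣q∣ (x∈p⇒⁅x⁆⊆p x∈p)))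
... | ()

∣p∣≡1⇒∃! : ∀ {n} {p : Subset n} → ∣ p ∣ ≡ 1 → ∃! _≡_ (_∈ₛ p)
∣p∣≡1⇒∃! {p = p} ∣p∣≡1 with ∣p∣≢0⇒Nonempty p (λ ∣p∣≡0 → contradiction (trans (sym ∣p∣≡1) ∣p∣≡0) λ ())
... | x , x∈p = x , x∈p , unique
  where
  unique : ∀ {y} → y ∈ₛ p → x ≡ y
  unique {y} y∈p with x ≟ᶠ y
  ... | yes x≡y = x≡y
  ... | no x≢y = contradiction (subst (1 <_) ∣p∣≡1 (subst (_< ∣ p ∣) (∣⁅x⁆∣≡1 x) (p⊂q⇒∣p∣<∣q∣ ⁅x⁆⊂p))) (<-irrefl refl)
    where
    ⁅x⁆⊂p : ⁅ x ⁆ ⊂ p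
    ⁅x⁆⊂p = x∈p⇒⁅x⁆⊆p x∈p , y , y∈p , λ y∈⁅x⁆ → x≢y (sym (x∈⁅y⁆⇒x≡y x y∈⁅x⁆))

∩≡⊥⇒∉ : ∀ {n} {p q : Subset n} {x} → p ∩ q ≡ ⊥ → x ∈ₛ p → x ∉ₛ q
∩≡⊥⇒∉ {x = x} p∩q≡⊥ x∈p x∈q = ∉⊥ (subst (x ∈ₛ_) p∩q≡⊥ (x∈p∩q⁺ (x∈p , x∈q)))

∩≡⊥∧∣∣+∣∣≡n⇒∈⊎∈ : ∀ {n} {p q : Subset n} → p ∩ q ≡ ⊥ → ∣ p ∣ + ∣ q ∣ ≡ n → ∀ x → x ∈ₛ p ⊎ x ∈ₛ q
∩≡⊥∧∣∣+∣∣≡n⇒∈⊎∈ {n} {p} {q} p∩q≡⊥ sizes x with x ∈ₛ? p | x ∈ₛ? q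
... | yes x∈p | _ = inj₁ x∈p
... | no _ | yes x∈q = inj₂ x∈q
... | no x∉p | no x∉q = contradiction ∣q∣<∣q∣ (<-irrefl refl)
  where
  q⊂∁p : q ⊂ ∁ p
  q⊂∁p = (λ y∈q → x∉p⇒x∈∁p (λ y∈p → ∩≡⊥⇒∉ p∩q≡⊥ y∈p y∈q)) , x , x∉p⇒x∈∁p x∉p , x∉q
  ∣q∣<∣q∣ : ∣ q ∣ < ∣ q ∣
  ∣q∣<∣q∣ = subst (∣ q ∣ <_) (trans (∣∁p∣≡n∸∣p∣ p) (trans (cong (_∸ ∣ p ∣) (sym sizes)) (m+n∸m≡n ∣ p ∣ ∣ q ∣)))
              (p⊂q⇒∣p∣<∣q∣ q⊂∁p)

enumerate : ∀ {n} (p : Subset n) → Fin ∣ p ∣ → Fin n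
enumerate (inside ∷ p) zero = zero
enumerate (inside ∷ p) (suc k) = suc (enumerate p k)
enumerate (outside ∷ p) k = suc (enumerate p k)

enumerate∈ : ∀ {n} (p : Subset n) k → enumerate p k ∈ₛ p
enumerate∈ (inside ∷ p) zero = here
enumerate∈ (inside ∷ p) (suc k) = there (enumerate∈ p k)
enumerate∈ (outside ∷ p) k = there (enumerate∈ p k)

enumerate-injective : ∀ {n} (p : Subset n) → Injective _≡_ _≡_ (enumerate p)
enumerate-injective (inside ∷ p) {zero} {zero} _ = refl
enumerate-injective (inside ∷ p) {suc k} {suc k′} eq = cong suc (enumerate-injective p (suc-injective eq))
enumerate-injective (outside ∷ p) eq = enumerate-injective p (suc-injective eq)

enumerate-surjective : ∀ {n} (p : Subset n) {x} → x ∈ₛ p → ∃[ k ] enumerate p k ≡ x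
enumerate-surjective (inside ∷ p) here = zero , refl
enumerate-surjective (inside ∷ p) (there x∈p) with enumerate-surjective p x∈p
... | k , eq = suc k , cong suc eq
enumerate-surjective (outside ∷ p) (there x∈p) with enumerate-surjective p x∈p
... | k , eq = k , cong suc eq

record Enumeration {n} (p : Subset n) (m : ℕ) : Set where
  field
    element : Fin m → Fin n
    element∈ : ∀ k → element k ∈ₛ p
    element-injective : Injective _≡_ _≡_ element
    element-surjective : ∀ {x} → x ∈ₛ p → ∃[ k ] element k ≡ x

enumeration : ∀ {n m} (p : Subset n) → ∣ p ∣ ≡ m → Enumeration p m
enumeration p refl = record
  { element = enumerate p
  ; element∈ = enumerate∈ p
  ; element-injective = enumerate-injective p
  ; element-surjective = enumerate-surjective p
  }

∈-tabulate⁺ : ∀ {n} (f : Fin n → Bool) {x} → f x ≡ true → x ∈ₛ tabulate f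
∈-tabulate⁺ f {x} fx≡true = lookup⇒[]= x (tabulate f) (trans (lookup∘tabulate f x) fx≡true)

∈-tabulate⁻ : ∀ {n} (f : Fin n → Bool) {x} → x ∈ₛ tabulate f → f x ≡ true
∈-tabulate⁻ f {x} x∈ = trans (sym (lookup∘tabulate f x)) ([]=⇒lookup x∈)

≢0⇒not[≡ᵇ0] : ∀ {k} → k ≢ 0 → not (k ≡ᵇ 0) ≡ true
≢0⇒not[≡ᵇ0] {zero} k≢0 = contradiction refl k≢0
≢0⇒not[≡ᵇ0] {suc _} _ = refl

not[≡ᵇ0]⇒≢0 : ∀ {k} → not (k ≡ᵇ 0) ≡ true → k ≢ 0
not[≡ᵇ0]⇒≢0 {suc _} _ ()

module _ {n r : ℕ} (X : Fin n → Fin r) where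

  ∈-Part⁺ : ∀ {v i} → X v ≡ i → v ∈ₛ Part X i
  ∈-Part⁺ {v} {i} Xv≡i = ∈-tabulate⁺ (λ w → ⌊ X w ≟ᶠ i ⌋) (trans (isYes≗does (X v ≟ᶠ i)) (dec-true (X v ≟ᶠ i) Xv≡i))

  ∈-Part⁻ : ∀ {v i} → v ∈ₛ Part X i → X v ≡ i
  ∈-Part⁻ {v} {i} v∈ = toWitness (Equivalence.from T-≡ (∈-tabulate⁻ (λ w → ⌊ X w ≟ᶠ i ⌋) v∈))

  ∈-Π⁺ : ∀ {S v} → v ∈ₛ S → X v ∈ₛ Π X S
  ∈-Π⁺ {S} {v} v∈S = ∈-tabulate⁺ (λ i → not (∣ S ∩ Part X i ∣ ≡ᵇ 0))
    (≢0⇒not[≡ᵇ0] (x∈p⇒∣p∣≢0 (x∈p∩q⁺ (v∈S , ∈-Part⁺ refl))))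

  ∈-Π⁻ : ∀ {S i} → i ∈ₛ Π X S → ∃[ v ] v ∈ₛ S × X v ≡ i
  ∈-Π⁻ {S} {i} i∈ with ∣p∣≢0⇒Nonempty (S ∩ Part X i) (not[≡ᵇ0]⇒≢0 (∈-tabulate⁻ (λ j → not (∣ S ∩ Part X j ∣ ≡ᵇ 0)) i∈))
  ... | v , v∈ = v , proj₁ (x∈p∩q⁻ S (Part X i) v∈) , ∈-Part⁻ (proj₂ (x∈p∩q⁻ S (Part X i) v∈))

record Transversal {n r} (X : Fin n → Fin r) (G : Subset n) : Set where
  constructor transversal
  field
    meets-each-part-once : (i : Fin r) → ∣ G ∩ Part X i ∣ ≡ 1

module _ {n r} {X : Fin n → Fin r} {G : Subset n} (G-transversal : Transversal X G) where

  private
    unique-vertex : ∀ i → ∃! _≡_ (_∈ₛ G ∩ Part X i)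
    unique-vertex i = ∣p∣≡1⇒∃! (Transversal.meets-each-part-once G-transversal i)

  vertex : Fin r → Fin n
  vertex i = proj₁ (unique-vertex i)

  vertex∈ : ∀ i → vertex i ∈ₛ G
  vertex∈ i = proj₁ (x∈p∩q⁻ G (Part X i) (proj₁ (proj₂ (unique-vertex i))))

  X-vertex : ∀ i → X (vertex i) ≡ i
  X-vertex i = ∈-Part⁻ X (proj₂ (x∈p∩q⁻ G (Part X i) (proj₁ (proj₂ (unique-vertex i)))))

  vertex-unique : ∀ {v} → v ∈ₛ G → vertex (X v) ≡ v
  vertex-unique v∈G = proj₂ (proj₂ (unique-vertex _)) (x∈p∩q⁺ (v∈G , ∈-Part⁺ X refl))

vertex-agree : ∀ {n r} {X : Fin n → Fin r} {F G : Subset n} {J : Subset r}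
  (F-transversal : Transversal X F) (G-transversal : Transversal X G) →
  (∀ {v} → v ∈ₛ F → X v ∈ₛ J → v ∈ₛ G) →
  ∀ {i} → i ∈ₛ J → vertex G-transversal i ≡ vertex F-transversal i
vertex-agree {X = X} {J = J} F-transversal G-transversal trace⊆G {i} i∈J = begin
  vertex G-transversal i                               ≡⟨ cong (vertex G-transversal) (sym (X-vertex F-transversal i)) ⟩
  vertex G-transversal (X (vertex F-transversal i))    ≡⟨ vertex-unique G-transversal v∈G ⟩
  vertex F-transversal i                               ∎
  where
  open ≡-Reasoning
  v∈G : vertex F-transversal i ∈ₛ _
  v∈G = trace⊆G (vertex∈ F-transversal i) (subst (_∈ₛ J) (sym (X-vertex F-transversal i)) i∈J)

2≤n⇒∃≢ : ∀ {n} → 2 ≤ n → (j : Fin n) → ∃[ j′ ] j ≢ j′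
2≤n⇒∃≢ {suc zero} (s≤s ()) _
2≤n⇒∃≢ {suc (suc _)} _ j = punchIn j zero , λ j≡ → punchInᵢ≢i j zero (sym j≡)

-- What the construction uses of a q-star with kernel { v ∈ F : X v ∈ J }.
record Star {n r} (q : ℕ) (𝓖* : Family n) (X : Fin n → Fin r) (F : Subset n) (J : Subset r) : Set where
  field
    petal : Fin q → Subset n
    petal∈ : ∀ j → petal j ∈ 𝓖*
    trace⊆petal : ∀ j {v} → v ∈ₛ F → X v ∈ₛ J → v ∈ₛ petal j
    petals-meet-in-J : ∀ {j j′} → j ≢ j′ → ∀ {v} → v ∈ₛ petal j → v ∈ₛ petal j′ → X v ∈ₛ J

module _ {n r q} {𝓖* : Family n} {X : Fin n → Fin r} {𝓙 : Pred (Subset r) 0ℓ}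
         (semilattice : Semilattice q 𝓖* X 𝓙) where

  private
    Π𝓘≡𝓙 : ∀ {F} → F ∈ 𝓖* → ∀ J → 𝓙 J ⇔ InΠI X F 𝓖* J
    Π𝓘≡𝓙 = proj₁ (proj₂ (proj₂ semilattice))

    stars : ∀ {F} → F ∈ 𝓖* → ∀ K → InI F 𝓖* K → StarThrough q 𝓖* F K
    stars = proj₂ (proj₂ (proj₂ (proj₂ semilattice)))

  member-transversal : ∀ {G} → G ∈ 𝓖* → Transversal X G
  member-transversal G∈ = transversal (proj₁ semilattice G∈)

  star : 2 ≤ q → ∀ {F J} → F ∈ 𝓖* → 𝓙 J → Star q 𝓖* X F J
  star 2≤q {F} {J} F∈ J∈𝓙 with Equivalence.to (Π𝓘≡𝓙 F∈ J) J∈𝓙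
  ... | K , K∈𝓘@(F′ , _ , _ , K≡F∩F′) , ΠK≡J
      with stars F∈ K K∈𝓘
  ...   | S , S∈ , _ , S∩S≡K , _ = record
    { petal = S
    ; petal∈ = S∈
    ; trace⊆petal = trace⊆petal
    ; petals-meet-in-J = λ j≢j′ {v} v∈ v∈′ → K⇒J (subst (v ∈ₛ_) (S∩S≡K _ _ j≢j′) (x∈p∩q⁺ (v∈ , v∈′)))
    }
    where
    F-transversal : Transversal X F
    F-transversal = member-transversal F∈

    K⇒J : ∀ {v} → v ∈ₛ K → X v ∈ₛ J
    K⇒J {v} v∈K = subst (X v ∈ₛ_) ΠK≡J (∈-Π⁺ X v∈K)

    trace⊆K : ∀ {v} → v ∈ₛ F → X v ∈ₛ J → v ∈ₛ K
    trace⊆K {v} v∈F Xv∈J with ∈-Π⁻ X (subst (X v ∈ₛ_) (sym ΠK≡J) Xv∈J)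
    ... | w , w∈K , Xw≡Xv = subst (_∈ₛ K) w≡v w∈K
      where
      open ≡-Reasoning
      w∈F : w ∈ₛ F
      w∈F = proj₁ (x∈p∩q⁻ F F′ (subst (w ∈ₛ_) K≡F∩F′ w∈K))
      w≡v : w ≡ v
      w≡v = begin
        w                          ≡⟨ sym (vertex-unique F-transversal w∈F) ⟩
        vertex F-transversal (X w) ≡⟨ cong (vertex F-transversal) Xw≡Xv ⟩
        vertex F-transversal (X v) ≡⟨ vertex-unique F-transversal v∈F ⟩
        v                          ∎

    trace⊆petal : ∀ j {v} → v ∈ₛ F → X v ∈ₛ J → v ∈ₛ S j
    trace⊆petal j {v} v∈F Xv∈J with 2≤n⇒∃≢ 2≤q j
    ... | j′ , j≢j′ = proj₁ (x∈p∩q⁻ (S j) (S j′) (subst (v ∈ₛ_) (sym (S∩S≡K j j′ j≢j′)) (trace⊆K v∈F Xv∈J)))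

module _ {V : Set} (_≟_ : DecidableEquality V) {a q : ℕ} where

  open DecMembership _≟_ using (_∈?_)

  -- Blocks with different indices are disjoint, so each element of L meets at most one block.
  block-avoiding : (L : List V) → length L < q → (block : Fin q → Fin a → V) →
    (∀ {j j′ k k′} → block j k ≡ block j′ k′ → j ≡ j′) →
    ∃[ j ] ∀ k → block j k ∉ L
  block-avoiding L ∣L∣<q block disjoint
    with ¬∀⟶∃¬ q (λ j → ∃[ k ] block j k ∈ L) (λ j → any? (λ k → block j k ∈? L)) every-block-meets-L
    where
    every-block-meets-L : ¬ (∀ j → ∃[ k ] block j k ∈ L)
    every-block-meets-L meets = <⇒≱ ∣L∣<q (injective⇒≤ hit-injective)
      where
      hit : Fin q → Fin (length L)
      hit j = index (proj₂ (meets j))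
      hit-injective : Injective _≡_ _≡_ hit
      hit-injective {j} {j′} hit≡ = disjoint (begin
        block j _                             ≡⟨ lookup-index (proj₂ (meets j)) ⟩
        lookupᴸ L (hit j)                     ≡⟨ cong (lookupᴸ L) hit≡ ⟩
        lookupᴸ L (hit j′)                    ≡⟨ sym (lookup-index (proj₂ (meets j′))) ⟩
        block j′ _                            ∎)
        where open ≡-Reasoning
  ... | j , misses = j , λ k block∈L → misses (k , block∈L)

  BlockChoice : ∀ m → List V → (Fin m → Fin q → Fin a → V) → Set
  BlockChoice m L blocks =
    Σ (Fin m → Fin q) λ choice →
      (∀ t k → blocks t (choice t) k ∉ L) ×
      (∀ {t t′} → t ≢ t′ → ∀ k k′ → blocks t (choice t) k ≢ blocks t′ (choice t′) k′)

  -- Each step puts the a elements of the chosen block into L and needs fewer than q elements in L.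
  choose-blocks : ∀ m (L : List V) → length L + m * a < q + a →
    (blocks : Fin m → Fin q → Fin a → V) →
    (∀ t {j j′ k k′} → blocks t j k ≡ blocks t j′ k′ → j ≡ j′) →
    BlockChoice m L blocks
  choose-blocks zero L _ blocks _ = (λ ()) , (λ ()) , λ { {()} }
  choose-blocks (suc m) L bound blocks disjoint = extend (block-avoiding L ∣L∣<q (blocks zero) (disjoint zero))
    where
    ∣L∣<q : length L < q
    ∣L∣<q = +-cancelʳ-< a (length L) q (≤-<-trans (+-monoʳ-≤ (length L) (m≤m+n a (m * a))) bound)

    extend : ∃[ j ] (∀ k → blocks zero j k ∉ L) → BlockChoice (suc m) L blocks
    extend (j₀ , j₀-avoids) = cons (choose-blocks m L′ bound′ (λ t → blocks (suc t)) (λ t → disjoint (suc t)))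
      where
      L′ : List V
      L′ = L ++ tabulateᴸ (blocks zero j₀)

      bound′ : length L′ + m * a < q + a
      bound′ = subst (_< q + a) (begin
        length L + (a + m * a)                                 ≡⟨ sym (+-assoc (length L) a (m * a)) ⟩
        length L + a + m * a                                   ≡⟨ cong (λ ℓ → length L + ℓ + m * a) (sym (length-tabulate (blocks zero j₀))) ⟩
        length L + length (tabulateᴸ (blocks zero j₀)) + m * a ≡⟨ cong (_+ m * a) (sym (length-++ L)) ⟩
        length L′ + m * a                                      ∎) bound
        where open ≡-Reasoning

      block₀∈L′ : ∀ k → blocks zero j₀ k ∈ L′
      block₀∈L′ k = ∈-++⁺ʳ L (∈ᴸ-tabulate⁺ k)

      cons : BlockChoice m L′ (λ t → blocks (suc t)) → BlockChoice (suc m) L blocks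
      cons (choice , avoid , apart) = choice′ , avoid′ , apart′
        where
        choice′ : Fin (suc m) → Fin q
        choice′ zero = j₀
        choice′ (suc t) = choice t

        avoid′ : ∀ t k → blocks t (choice′ t) k ∉ L
        avoid′ zero = j₀-avoids
        avoid′ (suc t) k ∈L = avoid t k (∈-++⁺ˡ ∈L)

        apart′ : ∀ {t t′} → t ≢ t′ → ∀ k k′ → blocks t (choice′ t) k ≢ blocks t′ (choice′ t′) k′
        apart′ {zero} {zero} t≢t′ = contradiction refl t≢t′
        apart′ {zero} {suc t′} _ k k′ eq = avoid t′ k′ (subst (_∈ L′) eq (block₀∈L′ k))
        apart′ {suc t} {zero} _ k k′ eq = avoid t k (subst (_∈ L′) (sym eq) (block₀∈L′ k′))
        apart′ {suc t} {suc t′} t≢t′ = apart (λ t≡t′ → t≢t′ (cong suc t≡t′))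

module BushFromStars {n a b s h q : ℕ} {𝓖* : Family n} {X : Fin n → Fin (a + b)} {𝓙 : Pred (Subset (a + b)) 0ℓ}
  (semilattice : Semilattice q 𝓖* X 𝓙) (2≤q : 2 ≤ q) (s≤q : s ≤ q) (sha<q : s * h * a < q)
  {F : Subset n} (F∈ : F ∈ 𝓖*) {A B : Subset (a + b)} (A∈𝓙 : 𝓙 A) (B∈𝓙 : 𝓙 B)
  (A∩B≡⊥ : A ∩ B ≡ ⊥) (∣A∣≡a : ∣ A ∣ ≡ a) (∣B∣≡b : ∣ B ∣ ≡ b) where

  open Star
  module EA = Enumeration (enumeration A ∣A∣≡a)
  module EB = Enumeration (enumeration B ∣B∣≡b)

  partA : Fin a → Fin (a + b)
  partA = EA.element

  partB : Fin b → Fin (a + b)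
  partB = EB.element

  partA≢partB : ∀ {k k′} → partA k ≢ partB k′
  partA≢partB {k} {k′} eq = ∩≡⊥⇒∉ A∩B≡⊥ (EA.element∈ k) (subst (_∈ₛ B) (sym eq) (EB.element∈ k′))

  transversal-of : ∀ {G} → G ∈ 𝓖* → Transversal X G
  transversal-of = member-transversal semilattice

  vtx : ∀ {G} → G ∈ 𝓖* → Fin (a + b) → Fin n
  vtx G∈ = vertex (transversal-of G∈)

  X-vtx : ∀ {G} (G∈ : G ∈ 𝓖*) i → X (vtx G∈ i) ≡ i
  X-vtx G∈ = X-vertex (transversal-of G∈)

  vtx∈ : ∀ {G} (G∈ : G ∈ 𝓖*) i → vtx G∈ i ∈ₛ G
  vtx∈ G∈ = vertex∈ (transversal-of G∈)

  petal-vtx : ∀ {G J} (G∈ : G ∈ 𝓖*) (st : Star q 𝓖* X G J) j {i} → i ∈ₛ J → vtx (petal∈ st j) i ≡ vtx G∈ i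
  petal-vtx G∈ st j = vertex-agree (transversal-of G∈) (transversal-of (petal∈ st j)) (trace⊆petal st j)

  ∈⇔vertex-in-A⊎B : ∀ {G} (G∈ : G ∈ 𝓖*) {f : Fin a → Fin n} {g : Fin b → Fin n} →
    (∀ k → vtx G∈ (partA k) ≡ f k) → (∀ k → vtx G∈ (partB k) ≡ g k) →
    ∀ v → v ∈ₛ G ⇔ ((∃[ k ] f k ≡ v) ⊎ (∃[ k ] g k ≡ v))
  ∈⇔vertex-in-A⊎B {G} G∈ {f} {g} on-A on-B v = mk⇔ to from
    where
    vtx-X : v ∈ₛ G → vtx G∈ (X v) ≡ v
    vtx-X = vertex-unique (transversal-of G∈)

    to : v ∈ₛ G → (∃[ k ] f k ≡ v) ⊎ (∃[ k ] g k ≡ v)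
    to v∈G with ∩≡⊥∧∣∣+∣∣≡n⇒∈⊎∈ A∩B≡⊥ (trans (cong (_+ ∣ B ∣) ∣A∣≡a) (cong (a +_) ∣B∣≡b)) (X v)
    ... | inj₁ Xv∈A = let k , partAk≡Xv = EA.element-surjective Xv∈A in
      inj₁ (k , trans (sym (on-A k)) (trans (cong (vtx G∈) partAk≡Xv) (vtx-X v∈G)))
    ... | inj₂ Xv∈B = let k , partBk≡Xv = EB.element-surjective Xv∈B in
      inj₂ (k , trans (sym (on-B k)) (trans (cong (vtx G∈) partBk≡Xv) (vtx-X v∈G)))

    from : (∃[ k ] f k ≡ v) ⊎ (∃[ k ] g k ≡ v) → v ∈ₛ G
    from (inj₁ (k , refl)) = subst (_∈ₛ G) (on-A k) (vtx∈ G∈ (partA k))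
    from (inj₂ (k , refl)) = subst (_∈ₛ G) (on-B k) (vtx∈ G∈ (partB k))

  A-star : Star q 𝓖* X F A
  A-star = star semilattice 2≤q F∈ A∈𝓙

  P : Fin s → Subset n
  P i = petal A-star (inject≤ i s≤q)

  P∈ : ∀ i → P i ∈ 𝓖*
  P∈ i = petal∈ A-star (inject≤ i s≤q)

  B-star : ∀ i → Star q 𝓖* X (P i) B
  B-star i = star semilattice 2≤q (P∈ i) B∈𝓙

  block : Fin s → Fin q → Fin a → Fin n
  block i j k = vtx (petal∈ (B-star i) j) (partA k)

  block-disjoint : ∀ i {j j′ k k′} → block i j k ≡ block i j′ k′ → j ≡ j′
  block-disjoint i {j} {j′} {k} {k′} eq with j ≟ᶠ j′
  ... | yes j≡j′ = j≡j′
  ... | no j≢j′ = ⊥-elim (∩≡⊥⇒∉ A∩B≡⊥ Xv∈A Xv∈B)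
    where
    Xv∈A : X (block i j k) ∈ₛ A
    Xv∈A = subst (_∈ₛ A) (sym (X-vtx (petal∈ (B-star i) j) (partA k))) (EA.element∈ k)
    Xv∈B : X (block i j k) ∈ₛ B
    Xv∈B = petals-meet-in-J (B-star i) j≢j′ (vtx∈ (petal∈ (B-star i) j) (partA k))
             (subst (_∈ₛ petal (B-star i) j′) (sym eq) (vtx∈ (petal∈ (B-star i) j′) (partA k′)))

  slot : Fin (s * h) → Fin s
  slot t = proj₁ (remQuot h t)

  slot-combine : ∀ i j → slot (combine i j) ≡ i
  slot-combine i j = cong proj₁ (remQuot-combine i j)

  F-vertices : List (Fin n)
  F-vertices = tabulateᴸ (λ k → vtx F∈ (partA k))

  room : length F-vertices + s * h * a < q + a
  room = subst (λ ℓ → ℓ + s * h * a < q + a) (sym (length-tabulate (λ k → vtx F∈ (partA k))))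
           (subst (_< q + a) (+-comm (s * h * a) a) (+-monoˡ-< a sha<q))

  private
    chosen : BlockChoice _≟ᶠ_ (s * h) F-vertices (λ t → block (slot t))
    chosen = choose-blocks _≟ᶠ_ (s * h) F-vertices room (λ t → block (slot t)) (λ t → block-disjoint (slot t))

  choice : Fin (s * h) → Fin q
  choice = proj₁ chosen

  φ : BushV a b s h → Fin n
  φ (vA k) = vtx F∈ (partA k)
  φ (vB i k) = vtx (P∈ i) (partB k)
  φ (vC i j k) = block i (choice (combine i j)) k

  φ-vC : ∀ i j k → φ (vC i j k) ≡ block (slot (combine i j)) (choice (combine i j)) k
  φ-vC i j k = cong (λ i′ → block i′ (choice (combine i j)) k) (sym (slot-combine i j))

  part : BushV a b s h → Fin (a + b)
  part (vA k) = partA k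
  part (vB i k) = partB k
  part (vC i j k) = partA k

  X-φ : ∀ x → X (φ x) ≡ part x
  X-φ (vA k) = X-vtx F∈ (partA k)
  X-φ (vB i k) = X-vtx (P∈ i) (partB k)
  X-φ (vC i j k) = X-vtx (petal∈ (B-star i) (choice (combine i j))) (partA k)

  φ-injective : Injective _≡_ _≡_ φ
  φ-injective {x} {y} φx≡φy = by-part x y φx≡φy (trans (sym (X-φ x)) (trans (cong X φx≡φy) (X-φ y)))
    where
    avoids-F : ∀ i j k k′ → vtx F∈ (partA k) ≢ φ (vC i j k′)
    avoids-F i j k k′ eq = proj₁ (proj₂ chosen) (combine i j) k′
      (subst (_∈ F-vertices) (trans eq (φ-vC i j k′)) (∈ᴸ-tabulate⁺ k))

    by-part : ∀ x y → φ x ≡ φ y → part x ≡ part y → x ≡ y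
    by-part (vA k) (vA k′) _ p≡ = cong vA (EA.element-injective p≡)
    by-part (vA k) (vB _ k′) _ p≡ = contradiction p≡ partA≢partB
    by-part (vA k) (vC i j k′) eq _ = contradiction eq (avoids-F i j k k′)
    by-part (vB _ k) (vA k′) _ p≡ = contradiction (sym p≡) partA≢partB
    by-part (vB i k) (vB i′ k′) eq p≡ with i ≟ᶠ i′
    ... | yes refl = cong (vB i) (EB.element-injective p≡)
    ... | no i≢i′ = ⊥-elim (∩≡⊥⇒∉ A∩B≡⊥ Xv∈A Xv∈B)
      where
      Xv∈A : X (φ (vB i k)) ∈ₛ A
      Xv∈A = petals-meet-in-J A-star (λ inj≡ → i≢i′ (inject≤-injective s≤q s≤q i i′ inj≡))
               (vtx∈ (P∈ i) (partB k)) (subst (_∈ₛ P i′) (sym eq) (vtx∈ (P∈ i′) (partB k′)))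
      Xv∈B : X (φ (vB i k)) ∈ₛ B
      Xv∈B = subst (_∈ₛ B) (sym (X-φ (vB i k))) (EB.element∈ k)
    by-part (vB _ k) (vC _ _ k′) _ p≡ = contradiction (sym p≡) partA≢partB
    by-part (vC i j k) (vA k′) eq _ = contradiction (sym eq) (avoids-F i j k′ k)
    by-part (vC _ _ k) (vB _ k′) _ p≡ = contradiction p≡ partA≢partB
    by-part (vC i j k) (vC i′ j′ k′) eq p≡ with combine i j ≟ᶠ combine i′ j′
    ... | no t≢t′ = contradiction (trans (sym (φ-vC i j k)) (trans eq (φ-vC i′ j′ k′))) (proj₂ (proj₂ chosen) t≢t′ k k′)
    ... | yes t≡t′ with combine-injective i j i′ j′ t≡t′
    ...   | refl , refl = cong (vC i j) (EA.element-injective p≡)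

  A∪B-edge : ∀ i → ∃[ E ] (E ∈ 𝓖* × (∀ v → (v ∈ₛ E) ⇔ ((∃[ k ] φ (vA k) ≡ v) ⊎ (∃[ k ] φ (vB i k) ≡ v))))
  A∪B-edge i = P i , P∈ i , ∈⇔vertex-in-A⊎B (P∈ i) (λ k → petal-vtx F∈ A-star (inject≤ i s≤q) (EA.element∈ k)) (λ _ → refl)

  B∪A-edge : ∀ i j → ∃[ E ] (E ∈ 𝓖* × (∀ v → (v ∈ₛ E) ⇔ ((∃[ k ] φ (vB i k) ≡ v) ⊎ (∃[ k ] φ (vC i j k) ≡ v))))
  B∪A-edge i j = petal (B-star i) j′ , petal∈ (B-star i) j′ ,
    λ v → ⇔.trans (∈⇔vertex-in-A⊎B (petal∈ (B-star i) j′) (λ _ → refl) (λ k → petal-vtx (P∈ i) (B-star i) j′ (EB.element∈ k)) v)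
                   (↔⇒⇔ (⊎-comm _ _))
    where j′ = choice (combine i j)

  bush : ContainsBush a b s h 𝓖*
  bush = φ , φ-injective , A∪B-edge , B∪A-edge

ContainsBush-mono : ∀ {n a b s h} {𝓕 𝓖 : Family n} → Subfamily 𝓕 𝓖 → ContainsBush a b s h 𝓕 → ContainsBush a b s h 𝓖
ContainsBush-mono 𝓕⊆𝓖 (φ , φ-injective , A∪B-edge , B∪A-edge) =
  φ , φ-injective ,
  (λ i → let E , E∈ , E⇔ = A∪B-edge i in E , 𝓕⊆𝓖 E∈ , E⇔) ,
  (λ i j → let E , E∈ , E⇔ = B∪A-edge i j in E , 𝓕⊆𝓖 E∈ , E⇔)

∃∈-of-length : ∀ {A : Set} (xs : List A) → 0 < length xs → ∃ (_∈ xs)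
∃∈-of-length (x ∷ _) _ = x , here refl

-- k / C < g forces g > 0, hence C g > 0.
÷<∧*≤⇒0< : (C : ℚ) {{_ : Positive C}} (k g m : ℕ) →
  ((ℕ→ℚ k ÷ C) {{pos⇒nonZero C}} <ℚ ℕ→ℚ g) → C *ℚ ℕ→ℚ g ≤ℚ ℕ→ℚ m → 0 < m
÷<∧*≤⇒0< C k g zero k/C<g Cg≤0 = contradiction (ℚ.<-≤-trans (ℚ.positive⁻¹ (C *ℚ ℕ→ℚ g) {{Cg>0}}) Cg≤0) (ℚ.<-irrefl refl)
  where
  instance
    C≢0 : NonZero C
    C≢0 = pos⇒nonZero C
  k/C≥0 : NonNegative (ℕ→ℚ k *ℚ 1/ C)
  k/C≥0 = ℚ.nonNeg*nonNeg⇒nonNeg (ℕ→ℚ k) {{ℚ.normalize-nonNeg k 1}} (1/ C) {{ℚ.pos⇒nonNeg (1/ C) {{ℚ.1/pos⇒pos C}}}}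
  g>0 : Positive (ℕ→ℚ g)
  g>0 = positive (ℚ.≤-<-trans (ℚ.nonNegative⁻¹ _ {{k/C≥0}}) k/C<g)
  Cg>0 : Positive (C *ℚ ℕ→ℚ g)
  Cg>0 = ℚ.pos*pos⇒pos C (ℕ→ℚ g) {{g>0}}
÷<∧*≤⇒0< C k g (suc m) _ _ = s≤s z≤n

m*n<m*[n+o] : ∀ m n o → 0 < m * o → m * n < m * (n + o)
m*n<m*[n+o] m n o 0<mo = subst (m * n <_) (sym (*-distribˡ-+ m n o)) (m<m+n (m * n) 0<mo)

lemma8 : (c : ℕ → ℕ → ℚ) → (c-pos : ∀ r q → Positive (c r q)) →
    (a b s h n : ℕ) → 1 ≤ a → 1 ≤ b → 1 ≤ h → 2 ≤ s →
    (𝓖 : Family n) → Unique 𝓖 → Uniform (a + b) 𝓖 →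
    (((ℕ→ℚ (n ^ (a + b ∸ 2))) ÷ c (a + b) (s * h * (a + b)))
       {{pos⇒nonZero (c (a + b) (s * h * (a + b))) {{c-pos (a + b) (s * h * (a + b))}}}}
       <ℚ ℕ→ℚ ∣ 𝓖 ∣F) →
    ¬ ContainsBush a b s h 𝓖 →
    (𝓖* : Family n) → Unique 𝓖* → Subfamily 𝓖* 𝓖 →
    (X : Fin n → Fin (a + b)) → (𝓙 : Pred (Subset (a + b)) 0ℓ) →
    c (a + b) (s * h * (a + b)) *ℚ ℕ→ℚ ∣ 𝓖 ∣F ≤ℚ ℕ→ℚ ∣ 𝓖* ∣F →
    Semilattice (s * h * (a + b)) 𝓖* X 𝓙 →
    ¬ (Σ (Subset (a + b)) λ A → Σ (Subset (a + b)) λ B →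
         𝓙 A × 𝓙 B × A ∩ B ≡ ⊥ × ∣ A ∣ ≡ a × ∣ B ∣ ≡ b)
lemma8 c c-pos a b s h n 1≤a 1≤b 1≤h 2≤s 𝓖 _ _ 𝓖-large 𝓖∌bush 𝓖* _ 𝓖*⊆𝓖 X 𝓙 𝓖*-large semilattice
       (A , B , A∈𝓙 , B∈𝓙 , A∩B≡⊥ , ∣A∣≡a , ∣B∣≡b) =
  𝓖∌bush (ContainsBush-mono 𝓖*⊆𝓖 (BushFromStars.bush semilattice 2≤q s≤q sha<q (proj₂ 𝓖*-nonempty) A∈𝓙 B∈𝓙 A∩B≡⊥ ∣A∣≡a ∣B∣≡b))
  where
  q : ℕ
  q = s * h * (a + b)

  s≤q : s ≤ q
  s≤q = ≤-trans (m≤m*n s h {{>-nonZero 1≤h}}) (m≤m*n (s * h) (a + b) {{>-nonZero (≤-trans 1≤a (m≤m+n a b))}})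

  2≤q : 2 ≤ q
  2≤q = ≤-trans 2≤s s≤q

  sha<q : s * h * a < q
  sha<q = m*n<m*[n+o] (s * h) a b (*-mono-≤ (*-mono-≤ (≤-trans (s≤s z≤n) 2≤s) 1≤h) 1≤b)

  𝓖*-nonempty : ∃ (_∈ 𝓖*)
  𝓖*-nonempty = ∃∈-of-length 𝓖* (÷<∧*≤⇒0< (c (a + b) q) {{c-pos (a + b) q}} (n ^ (a + b ∸ 2)) ∣ 𝓖 ∣F ∣ 𝓖* ∣F 𝓖-large 𝓖*-large)
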